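{- Let $\mathcal{E}=\{A_n\}_{n\ge 1}$ and $\mathcal{F}=\{B_n\}_{n\ge 1}$ be countable collections of infinite sets, and let $V=\left(\bigcup\mathcal{E}\right)\cup\left(\bigcup\mathcal{F}\right)$. Then $\langle V,\mathcal{E},\mathcal{F}\rangle$ has Property S.
   Context: Let $V$ be a set and $\mathcal{E},\mathcal{F}$ families of subsets of $V$. A set $X$ is a transversal for a family $\mathcal{A}$ if $X\cap A\neq\emptyset$ for every $A\in\mathcal{A}$. The triple $\langle V,\mathcal{E},\mathcal{F}\rangle$ (equivalently, the pair $\mathcal{E},\mathcal{F}$) has Property S if there is a set $X\subseteq V$ such that $X$ is a transversal for $\mathcal{E}$ and $V\setminus X$ is a transversal for $\mathcal{F}$; the partition $\{X,V\setminus X\}$ is then called an S-partition. -}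

module Defs where

open import Level using (0ℓ)
open import Data.Nat using (ℕ)
open import Data.Product using (Σ; ∃; _×_)
open import Data.Sum using (_⊎_)
open import Data.List using (List)
open import Data.List.Membership.Propositional using (_∉_)
open import Relation.Unary using (Pred; _⊆_; _∩_; ∁)

Infinite : {U : Set} → Pred U 0ℓ → Set
Infinite {U} A = (l : List U) → ∃ λ x → A x × x ∉ l

⋃ : {U I : Set} → (I → Pred U 0ℓ) → Pred U 0ℓ
⋃ {I = I} 𝒜 x = ∃ λ (i : I) → 𝒜 i x

Transversal : {U I : Set} → Pred U 0ℓ → (I → Pred U 0ℓ) → Set
Transversal X 𝒜 = ∀ i → ∃ λ x → X x × 𝒜 i x

_∖_ : {U : Set} → Pred U 0ℓ → Pred U 0ℓ → Pred U 0ℓ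
V ∖ X = V ∩ ∁ X

PropertyS : {U I J : Set} → Pred U 0ℓ → (I → Pred U 0ℓ) → (J → Pred U 0ℓ) → Set₁
PropertyS V 𝓔 𝓕 = Σ (Pred _ 0ℓ) λ X → X ⊆ V × Transversal X 𝓔 × Transversal (V ∖ X) 𝓕

-- Choose the points a₀, b₀, a₁, b₁, … in turn, with aₙ ∈ Aₙ and bₙ ∈ Bₙ
-- each distinct from all points chosen before it; this is possible since
-- every member of both families is infinite. Then every bₙ differs from
-- every aₘ, so X = {aₘ} meets each Aₙ while V ∖ X contains bₙ ∈ Bₙ.
module Submission where

open import Defs
open import Level using (0ℓ)
open import Data.Nat using (ℕ; zero; suc; _≤′_; ≤′-refl; ≤′-step; _<_)
open import Data.Nat.Properties using (≤⇒≤′; <-cmp)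
open import Data.Sum using (_⊎_; inj₁; inj₂)
open import Data.Product using (∃; _,_; proj₁; proj₂)
open import Data.List using (List; []; _∷_)
open import Data.List.Relation.Unary.Any using (here; there)
open import Data.List.Membership.Propositional using (_∈_; _∉_)
open import Relation.Unary using (Pred)
open import Relation.Binary using (tri<; tri≈; tri>)
open import Relation.Binary.PropositionalEquality using (_≡_; _≢_; refl; sym; subst)

module InterleavedFreshChoice {U : Set} (A B : ℕ → Pred U 0ℓ)
  (A-infinite : ∀ n → Infinite (A n)) (B-infinite : ∀ n → Infinite (B n)) where

  history : ℕ → List U
  a b : ℕ → U

  history zero    = []
  history (suc n) = b n ∷ a n ∷ history n

  a n = proj₁ (A-infinite n (history n))
  b n = proj₁ (B-infinite n (a n ∷ history n))

  a∈A : ∀ n → A n (a n)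
  a∈A n = proj₁ (proj₂ (A-infinite n (history n)))

  a∉history : ∀ n → a n ∉ history n
  a∉history n = proj₂ (proj₂ (A-infinite n (history n)))

  b∈B : ∀ n → B n (b n)
  b∈B n = proj₁ (proj₂ (B-infinite n (a n ∷ history n)))

  b∉a∷history : ∀ n → b n ∉ a n ∷ history n
  b∉a∷history n = proj₂ (proj₂ (B-infinite n (a n ∷ history n)))

  history-mono : ∀ {m n x} → m ≤′ n → x ∈ history m → x ∈ history n
  history-mono ≤′-refl        x∈ = x∈
  history-mono (≤′-step m≤′n) x∈ = there (there (history-mono m≤′n x∈))

  a∈history : ∀ {m n} → m < n → a m ∈ history n
  a∈history m<n = history-mono (≤⇒≤′ m<n) (there (here refl))

  b∈history : ∀ {m n} → m < n → b m ∈ history n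
  b∈history m<n = history-mono (≤⇒≤′ m<n) (here refl)

  b≢a : ∀ n m → b n ≢ a m
  b≢a n m bₙ≡aₘ with <-cmp m n
  ... | tri< m<n _ _ = b∉a∷history n (there (subst (_∈ history n) (sym bₙ≡aₘ) (a∈history m<n)))
  ... | tri≈ _ refl _ = b∉a∷history n (here bₙ≡aₘ)
  ... | tri> _ _ n<m = a∉history m (subst (_∈ history m) bₙ≡aₘ (b∈history n<m))

theorem2 : {U : Set} (A B : ℕ → Pred U 0ℓ) →
    (∀ n → Infinite (A n)) → (∀ n → Infinite (B n)) →
    PropertyS (λ x → ⋃ A x ⊎ ⋃ B x) A B
theorem2 {U} A B A-infinite B-infinite = X , X⊆V , X-meets-A , V∖X-meets-B
  where
  open InterleavedFreshChoice A B A-infinite B-infinite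

  X : Pred U 0ℓ
  X x = ∃ λ m → x ≡ a m

  X⊆V : ∀ {x} → X x → ⋃ A x ⊎ ⋃ B x
  X⊆V (m , refl) = inj₁ (m , a∈A m)

  X-meets-A : Transversal X A
  X-meets-A n = a n , (n , refl) , a∈A n

  V∖X-meets-B : Transversal ((λ x → ⋃ A x ⊎ ⋃ B x) ∖ X) B
  V∖X-meets-B n = b n , (inj₂ (n , b∈B n) , λ (m , bₙ≡aₘ) → b≢a n m bₙ≡aₘ) , b∈B n
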